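{- Let $R$ be a commutative ring with multiplicative identity, different from the zero ring, let $n\ge 2$, and let $f_i:R^{2i-2}\to R$, $2\le i\le n$, be arbitrary functions. Then the bipartite graphs $B\Gamma(R;f_2,\ldots,f_n)$ and $B\Gamma(R;\overline{f_2},\ldots,\overline{f_n})$ are isomorphic, and an explicit isomorphism is given by the map $\varphi$ sending each point $(a)$ to the line $[a]$ and each line $[a]$ to the point $(a)$, for every $a\in R^n$.
   Context: For functions $f_i:R^{2i-2}\to R$ ($2\le i\le n$), the bipartite graph $B\Gamma(R;f_2,\ldots,f_n)$ has vertex set the disjoint union of two copies of $R^n$: the set of points, whose elements are written $(p)=(p_1,\ldots,p_n)$, and the set of lines, whose elements are written $[l]=[l_1,\ldots,l_n]$. A point $(p)$ and a line $[l]$ are adjacent if and only if $p_i+l_i=f_i(p_1,l_1,p_2,l_2,\ldots,p_{i-1},l_{i-1})$ for all $2\le i\le n$; there are no other edges. For a function $f_i:R^{2i-2}\to R$, the function $\overline{f_i}:R^{2i-2}\to R$ is defined by $\overline{f_i}(x_1,y_1,\ldots,x_{i-1},y_{i-1})=f_i(y_1,x_1,\ldots,y_{i-1},x_{i-1})$. -}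

module Defs where

open import Level using (Level; _⊔_; Lift)
open import Algebra.Bundles using (CommutativeRing)
open import Data.Nat using (ℕ; zero; suc; _≤_; _<_; _≥_; s≤s; z≤n)
open import Data.Fin using (Fin; inject≤; fromℕ<)
open import Data.Vec using (Vec; []; _∷_; lookup; tabulate)
open import Data.Product using (Σ; _×_; _,_)
open import Data.Empty using (⊥)
open import Data.Nat.Properties using (<⇒≤)
open import Function.Bundles using (_⇔_)
open import Function.Definitions using (Bijective)
open import Relation.Binary.PropositionalEquality using (_≡_)

-- dbl k = 2k  (defined by recursion so that vectors of length 2k can be built pairwise)
dbl : ℕ → ℕ
dbl zero    = 0
dbl (suc k) = suc (suc (dbl k))

module _ {c ℓ : Level} (R : CommutativeRing c ℓ) where
  open CommutativeRing R

  -- A family f_2,...,f_n : f_i : R^{2i-2} → R.  With k = i - 1 (so 1 ≤ k < n),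
  -- the entry for k is a function R^{2k} → R.
  Family : ℕ → Set c
  Family n = (k : ℕ) → 1 ≤ k → k < n → Vec Carrier (dbl k) → Carrier

  interleave : {k : ℕ} → Vec Carrier k → Vec Carrier k → Vec Carrier (dbl k)
  interleave []       []       = []
  interleave (x ∷ xs) (y ∷ ys) = x ∷ y ∷ interleave xs ys

  swapPairs : (k : ℕ) → Vec Carrier (dbl k) → Vec Carrier (dbl k)
  swapPairs zero    []           = []
  swapPairs (suc k) (x ∷ y ∷ v) = y ∷ x ∷ swapPairs k v

  barFamily : {n : ℕ} → Family n → Family n
  barFamily f k h1 h2 v = f k h1 h2 (swapPairs k v)

  prefix : {n : ℕ} (k : ℕ) → k ≤ n → Vec Carrier n → Vec Carrier k
  prefix zero    h v = []
  prefix k h v = tabulate (λ j → lookup v (inject≤ j h))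

  data Vertex (n : ℕ) : Set c where
    point : Vec Carrier n → Vertex n
    line  : Vec Carrier n → Vertex n

  -- incidence: p_i + l_i = f_i(p_1,l_1,...,p_{i-1},l_{i-1}) for 2 ≤ i ≤ n
  -- (0-based coordinate index k = i - 1)
  Incident : {n : ℕ} → Family n → Vec Carrier n → Vec Carrier n → Set ℓ
  Incident {n} f p l =
    (k : ℕ) (h1 : 1 ≤ k) (h2 : k < n) →
      lookup p (fromℕ< h2) + lookup l (fromℕ< h2)
        ≈ f k h1 h2 (interleave (prefix k (<⇒≤ h2) p) (prefix k (<⇒≤ h2) l))

  Adj : {n : ℕ} → Family n → Vertex n → Vertex n → Set ℓ
  Adj f (point p) (line l)  = Incident f p l
  Adj f (line l)  (point p) = Incident f p l
  Adj f (point _) (point _) = Lift ℓ ⊥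
  Adj f (line _)  (line _)  = Lift ℓ ⊥

  IsIsomorphism : {n : ℕ} → Family n → Family n → (Vertex n → Vertex n) → Set (c ⊔ ℓ)
  IsIsomorphism {n} f g φ =
    Bijective _≡_ _≡_ φ × ((u v : Vertex n) → Adj f u v ⇔ Adj g (φ u) (φ v))

  Isomorphic : {n : ℕ} → Family n → Family n → Set (c ⊔ ℓ)
  Isomorphic {n} f g = Σ (Vertex n → Vertex n) (IsIsomorphism f g)

  φ : {n : ℕ} → Vertex n → Vertex n
  φ (point a) = line a
  φ (line a)  = point a

-- Transposing a vertex's coordinates, (a) ↦ [a] and [a] ↦ (a), turns the incidence
-- relation p_i + l_i = f_i(p_1,l_1,…) into l_i + p_i = f_i(p_1,l_1,…) = f̄_i(l_1,p_1,…),
-- which is incidence in BΓ(R; f̄); the map is its own inverse, hence a bijection.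
module Submission where

open import Defs
open import Algebra.Bundles using (CommutativeRing)
open import Data.Nat using (ℕ; _≥_)
open import Data.Nat.Properties using (<⇒≤)
open import Data.Product using (_×_; _,_)
open import Data.Vec using (Vec; []; _∷_)
open import Function.Base using (id)
open import Function.Bundles using (Bijection; mk↔ₛ′; mk⇔; _⇔_)
open import Function.Definitions using (Bijective)
open import Function.Properties.Inverse using (↔⇒⤖)
open import Relation.Binary.PropositionalEquality using (_≡_; refl; sym; cong)
open import Relation.Nullary using (¬_)

module _ {c ℓ} (R : CommutativeRing c ℓ) where
  open CommutativeRing R using (Carrier; trans; reflexive; +-comm)

  swapPairs-interleave : ∀ {k} (xs ys : Vec Carrier k) →
    swapPairs R k (interleave R xs ys) ≡ interleave R ys xs
  swapPairs-interleave []       []       = refl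
  swapPairs-interleave (x ∷ xs) (y ∷ ys) = cong (λ v → y ∷ x ∷ v) (swapPairs-interleave xs ys)

  φ-involutive : ∀ {n} (v : Vertex R n) → φ R (φ R v) ≡ v
  φ-involutive (point _) = refl
  φ-involutive (line _)  = refl

  φ-bijective : ∀ {n} → Bijective _≡_ _≡_ (φ R {n})
  φ-bijective = Bijection.bijective (↔⇒⤖ (mk↔ₛ′ (φ R) (φ R) φ-involutive φ-involutive))

  module _ {n : ℕ} (f : Family R n) where
    incident⇔incident-bar : ∀ p l → Incident R f p l ⇔ Incident R (barFamily R f) l p
    incident⇔incident-bar p l = mk⇔ to from
      where
      bar-transposed≡f : ∀ k h1 h2 →
        barFamily R f k h1 h2 (interleave R (prefix R k (<⇒≤ h2) l) (prefix R k (<⇒≤ h2) p))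
          ≡ f k h1 h2 (interleave R (prefix R k (<⇒≤ h2) p) (prefix R k (<⇒≤ h2) l))
      bar-transposed≡f k h1 h2 = cong (f k h1 h2) (swapPairs-interleave _ _)

      to : Incident R f p l → Incident R (barFamily R f) l p
      to H k h1 h2 = trans (+-comm _ _) (trans (H k h1 h2) (reflexive (sym (bar-transposed≡f k h1 h2))))

      from : Incident R (barFamily R f) l p → Incident R f p l
      from H k h1 h2 = trans (+-comm _ _) (trans (H k h1 h2) (reflexive (bar-transposed≡f k h1 h2)))

    adj⇔adj-bar-φ : (u v : Vertex R n) → Adj R f u v ⇔ Adj R (barFamily R f) (φ R u) (φ R v)
    adj⇔adj-bar-φ (point p) (line l)  = incident⇔incident-bar p l
    adj⇔adj-bar-φ (line l)  (point p) = incident⇔incident-bar p l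
    adj⇔adj-bar-φ (point _) (point _) = mk⇔ id id
    adj⇔adj-bar-φ (line _)  (line _)  = mk⇔ id id

    φ-isIsomorphism : IsIsomorphism R f (barFamily R f) (φ R)
    φ-isIsomorphism = φ-bijective , adj⇔adj-bar-φ

proposition2p1 : ∀ {c ℓ} (R : CommutativeRing c ℓ) →
    ¬ (CommutativeRing._≈_ R (CommutativeRing.1# R) (CommutativeRing.0# R)) →
    (n : ℕ) → n ≥ 2 → (f : Family R n) →
    Isomorphic R f (barFamily R f) × IsIsomorphism R f (barFamily R f) (φ R)
proposition2p1 R _ _ _ f = (φ R , φ-isIsomorphism R f) , φ-isIsomorphism R f
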